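{- Let $K\ge 1$, let $G=(V,E)$ be a $K$-edge-connected graph with a cactus representation $(\mathfrak C_G,\phi)$, and let $\widetilde T$ be a spanning tree of $G$ with congestion at most $K$. Then for every basic $K$-cut $\delta(Z)$ of $G$, all edges in $\widetilde T\cap\delta(Z)$ have a common endpoint.
   Context: For $\emptyset\neq X\subsetneq V$, $\delta(X)$ is the set of edges of $G$ with exactly one endpoint in $X$; it is a $K$-cut if $|\delta(X)|=K$. $G$ is $K$-edge-connected if it is connected and stays connected after deleting any $K-1$ edges. For a spanning tree $T$ and $e\in T$, the congestion of $e$ is $|\delta(S)|$ where $S$ is the vertex set of a component of $T-e$; the congestion of $T$ is the maximum over its edges. A cactus is a connected multigraph (nodes and links) in which every link lies on exactly one cycle (cycles of length $2$ allowed). A cactus representation of $G$ is a cactus $\mathfrak C_G=(U,F)$ with a map $\phi:V\to U$ such that for every $X\subseteq V$, $\delta(X)$ is a $K$-cut of $G$ iff $X=\phi^{ -1}(Q)$ for some $Q\subseteq U$ such that exactly two links join $Q$ and $U\setminus Q$ (a $2$-cut of $\mathfrak C_G$); every $2$-cut consists of two links of a common cycle. A $K$-cut of $G$ is basic if it is represented in this way by a $2$-cut consisting of two links of a common cycle that share a node. -}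

module Defs where

open import Data.Nat using (ℕ; zero; suc; _+_; _≤_; _∸_)
open import Data.Fin using (Fin; zero; suc; inject₁; fromℕ; _≟_)
open import Data.Bool using (Bool; true; false; if_then_else_; _xor_; _∧_; not)
open import Data.Product using (Σ; ∃; ∃-syntax; _×_; _,_)
open import Data.Sum using (_⊎_)
open import Relation.Binary.PropositionalEquality using (_≡_; _≢_)
open import Relation.Nullary using (¬_; does)
open import Function using (_∘_)
open import Function.Definitions using (Injective)
open import Function.Bundles using (_⇔_)

-- Finite multigraphs: vertices Fin nV, edges Fin nE, each edge has two
-- (ordered, but used symmetrically) endpoints.  Parallel edges allowed.

record Graph : Set where
  field
    nV  : ℕ
    nE  : ℕ
    src : Fin nE → Fin nV
    tgt : Fin nE → Fin nV
open Graph public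

countF : ∀ {k} → (Fin k → Bool) → ℕ
countF {zero}  _ = 0
countF {suc k} f = (if f zero then 1 else 0) + countF (f ∘ suc)

VSet : Graph → Set
VSet G = Fin (nV G) → Bool

ESet : Graph → Set
ESet G = Fin (nE G) → Bool

Joins : (G : Graph) → Fin (nE G) → Fin (nV G) → Fin (nV G) → Set
Joins G e u v = (src G e ≡ u × tgt G e ≡ v) ⊎ (src G e ≡ v × tgt G e ≡ u)

Incident : (G : Graph) → Fin (nE G) → Fin (nV G) → Set
Incident G e v = (src G e ≡ v) ⊎ (tgt G e ≡ v)

data Reach (G : Graph) (D : ESet G) (u : Fin (nV G)) : Fin (nV G) → Set where
  here : Reach G D u u
  step : ∀ {w x} (e : Fin (nE G)) → D e ≡ true → Reach G D u w → Joins G e w x →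
         Reach G D u x

Connected : (G : Graph) → ESet G → Set
Connected G D = ∀ u v → Reach G D u v

allE : (G : Graph) → ESet G
allE G _ = true

minus : (G : Graph) → ESet G → Fin (nE G) → ESet G
minus G D e f = D f ∧ not (does (f ≟ e))

crossB : (G : Graph) → VSet G → Fin (nE G) → Bool
crossB G X e = X (src G e) xor X (tgt G e)

Crosses : (G : Graph) → VSet G → Fin (nE G) → Set
Crosses G X e = crossB G X e ≡ true

cutSize : (G : Graph) → VSet G → ℕ
cutSize G X = countF (crossB G X)

NonemptyProper : (G : Graph) → VSet G → Set
NonemptyProper G X = (∃[ x ] X x ≡ true) × (∃[ y ] X y ≡ false)

IsKCut : (G : Graph) → ℕ → VSet G → Set
IsKCut G K X = NonemptyProper G X × cutSize G X ≡ K

KEdgeConnected : Graph → ℕ → Set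
KEdgeConnected G K =
  Connected G (allE G) ×
  (∀ (F : ESet G) → countF F ≤ K ∸ 1 → Connected G (not ∘ F))

-- T is a spanning tree: (V,T) is connected and acyclic (no edge of T
-- lies on a cycle of T, i.e. its endpoints are disconnected in T - e)
IsSpanningTree : (G : Graph) → ESet G → Set
IsSpanningTree G T =
  Connected G T ×
  (∀ e → T e ≡ true → ¬ Reach G (minus G T e) (src G e) (tgt G e))

-- congestion of T is at most K: for every e ∈ T, with S the vertex set
-- of the component of T - e containing (src e), |δ(S)| ≤ K
CongestionAtMost : (G : Graph) → ESet G → ℕ → Set
CongestionAtMost G T K =
  ∀ e → T e ≡ true →
  ∀ (S : VSet G) → (∀ v → (S v ≡ true) ⇔ Reach G (minus G T e) (src G e) v) →
  cutSize G S ≤ K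

-- a cycle of length suc j ≥ 2: distinct nodes node 0..j, distinct links,
-- link i joins node i and node (i+1), link j joins node j and node 0
record Cycle (C : Graph) : Set where
  field
    j        : ℕ
    j≥1      : 1 ≤ j
    node     : Fin (suc j) → Fin (nV C)
    link     : Fin (suc j) → Fin (nE C)
    node-inj : Injective _≡_ _≡_ node
    link-inj : Injective _≡_ _≡_ link
    joins    : ∀ (i : Fin j) → Joins C (link (inject₁ i)) (node (inject₁ i)) (node (suc i))
    closes   : Joins C (link (fromℕ j)) (node (fromℕ j)) (node zero)
open Cycle public

OnCycle : (C : Graph) → Fin (nE C) → Cycle C → Set
OnCycle C f Z = ∃[ i ] link Z i ≡ f

-- a cactus: connected, every link lies on exactly one cycle
-- (cycles compared as sets of links)
IsCactus : Graph → Set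
IsCactus C =
  Connected C (allE C) ×
  (∀ f → Σ (Cycle C) (OnCycle C f) ×
         (∀ (Z₁ Z₂ : Cycle C) → OnCycle C f Z₁ → OnCycle C f Z₂ →
            ∀ g → OnCycle C g Z₁ ⇔ OnCycle C g Z₂))

IsTwoCut : (C : Graph) → VSet C → Set
IsTwoCut C Q = cutSize C Q ≡ 2

Preimage : (G C : Graph) → (Fin (nV G) → Fin (nV C)) → VSet G → VSet C → Set
Preimage G C φ X Q = ∀ v → X v ≡ Q (φ v)

record CactusRep (G : Graph) (K : ℕ) : Set where
  field
    cactus    : Graph
    φ         : Fin (nV G) → Fin (nV cactus)
    isCactus  : IsCactus cactus
    represents : ∀ (X : VSet G) →
      IsKCut G K X ⇔ (∃[ Q ] IsTwoCut cactus Q × Preimage G cactus φ X Q)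
open CactusRep public

IsBasicKCut : (G : Graph) (K : ℕ) → CactusRep G K → VSet G → Set
IsBasicKCut G K R Z =
  IsKCut G K Z ×
  (∃[ Q ] IsTwoCut (cactus R) Q × Preimage G (cactus R) (φ R) Z Q ×
    (∃[ f₁ ] ∃[ f₂ ] f₁ ≢ f₂ ×
       Crosses (cactus R) Q f₁ × Crosses (cactus R) Q f₂ ×
       (∃[ Y ] OnCycle (cactus R) f₁ Y × OnCycle (cactus R) f₂ Y) ×
       (∃[ u ] Incident (cactus R) f₁ u × Incident (cactus R) f₂ u)))

{-# OPTIONS --safe #-}
-- For a tree edge g, let S be the component of T − g containing one end of g. K-edge-connectivity gives
-- |δ(S)| ≥ K and the congestion bound gives |δ(S)| ≤ K, so δ(S) is a K-cut, represented by a 2-cut of the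
-- cactus. A 2-cut of a cactus whose two links meet at a node u crosses no other 2-cut, so the basic cut Z
-- does not cross S: Z splits at most one of the two components of T − g. Hence two tree edges crossing δ(Z)
-- are never separated by a third tree edge, i.e. they share an endpoint. Finally, three crossing tree edges
-- that pairwise share endpoints without a common one would form a triangle crossed by δ(Z) in all three
-- edges, which no cut does.

module Submission where

open import Defs
open import Data.Nat using (ℕ; zero; suc; _+_; _≤_; _<_; z≤n; s≤s; _≤?_; _<?_)
open import Data.Nat.Properties using (≤-refl; ≤-trans; ≤-antisym; ≤-pred; <⇒≤; <⇒≢; <-irrefl; <-≤-trans; ≰⇒>; ∸-monoˡ-≤; m≤n⇒m≤1+n; m<n⇒m<1+n; m≤n⇒m<n∨m≡n)
open import Data.Fin using (Fin; zero; suc; toℕ; fromℕ<; fromℕ; inject₁; _≟_)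
open import Data.Fin.Properties using (any?; toℕ-injective; toℕ<n; toℕ-fromℕ<; toℕ-fromℕ; toℕ-inject₁)
open import Data.Empty using (⊥)
open import Data.Bool using (Bool; true; false; not; _∧_; _∨_; _xor_; if_then_else_)
open import Data.Bool.Properties using (⇔→≡; ¬-not; xor-assoc; xor-comm; xor-same; xor-inverseʳ; ∨-zeroʳ; ∧-zeroʳ) renaming (_≟_ to _≟ᵇ_)
open import Data.List using (List; []; _∷_; length)
open import Data.List.Relation.Unary.All as All using (All; []; _∷_)
open import Data.List.Relation.Unary.AllPairs using ([]; _∷_)
open import Data.List.Relation.Unary.Unique.Propositional using (Unique)
open import Data.Product using (Σ; ∃-syntax; _×_; _,_; proj₁; proj₂; map₂; curry)
open import Data.Sum using (_⊎_; inj₁; inj₂)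
open import Relation.Binary.PropositionalEquality using (_≡_; _≢_; refl; sym; trans; cong; subst; subst₂; ≢-sym; module ≡-Reasoning)
open import Relation.Nullary using (¬_; Dec; yes; no; does; contradiction)
open import Relation.Nullary.Decidable using (_×-dec_; _⊎-dec_; ¬?; dec-true; dec-false; decidable-stable)
open import Relation.Unary using (Decidable)
open import Function using (_∘_; flip)
open import Function.Bundles using (_⇔_; mk⇔; Equivalence)

infix 4 _⊆_
_⊆_ : ∀ {k} → (Fin k → Bool) → (Fin k → Bool) → Set
f ⊆ g = ∀ i → f i ≡ true → g i ≡ true

countF≤size : ∀ {k} (f : Fin k → Bool) → countF f ≤ k
countF≤size {zero}  _ = z≤n
countF≤size {suc k} f with f zero
... | true  = s≤s (countF≤size (f ∘ suc))
... | false = m≤n⇒m≤1+n (countF≤size (f ∘ suc))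

countF-mono : ∀ {k} {f g : Fin k → Bool} → f ⊆ g → countF f ≤ countF g
countF-mono {zero} _ = z≤n
countF-mono {suc k} {f} {g} f⊆g with f zero in f₀ | g zero in g₀
... | false | false = countF-mono (f⊆g ∘ suc)
... | false | true  = m≤n⇒m≤1+n (countF-mono (f⊆g ∘ suc))
... | true  | true  = s≤s (countF-mono (f⊆g ∘ suc))
... | true  | false = contradiction (trans (sym (f⊆g zero f₀)) g₀) λ ()

countF-< : ∀ {k} {f g : Fin k → Bool} → f ⊆ g → ∀ {x} → f x ≡ false → g x ≡ true →
           countF f < countF g
countF-< {suc k} {f} {g} f⊆g {zero} fx gx with f zero | g zero
... | false | true = s≤s (countF-mono (f⊆g ∘ suc))
countF-< {suc k} {f} {g} f⊆g {suc x} fx gx with f zero in f₀ | g zero in g₀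
... | false | false = countF-< (f⊆g ∘ suc) fx gx
... | false | true  = m<n⇒m<1+n (countF-< (f⊆g ∘ suc) fx gx)
... | true  | true  = s≤s (countF-< (f⊆g ∘ suc) fx gx)
... | true  | false = contradiction (trans (sym (f⊆g zero f₀)) g₀) λ ()

_without_ : ∀ {k} → (Fin k → Bool) → Fin k → (Fin k → Bool)
(f without x) i = if does (i ≟ x) then false else f i

without-⊆ : ∀ {k} (f : Fin k → Bool) x → f without x ⊆ f
without-⊆ f x i p with i ≟ x
... | no _ = p

without-self : ∀ {k} (f : Fin k → Bool) x → (f without x) x ≡ false
without-self f x with x ≟ x
... | yes _  = refl
... | no x≢x = contradiction refl x≢x

without-other : ∀ {k} (f : Fin k → Bool) {x y} → x ≢ y → (f without x) y ≡ f y
without-other f {x} {y} x≢y with y ≟ x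
... | yes y≡x = contradiction (sym y≡x) x≢y
... | no _    = refl

length≤countF : ∀ {k} {f : Fin k → Bool} (xs : List (Fin k)) → Unique xs →
                All (λ x → f x ≡ true) xs → length xs ≤ countF f
length≤countF [] _ _ = z≤n
length≤countF {f = f} (x ∷ xs) (x∉xs ∷ xs-unique) (fx ∷ fxs) =
  <-≤-trans (s≤s (length≤countF xs xs-unique (All.zipWith still-in (x∉xs , fxs))))
            (countF-< (without-⊆ f x) (without-self f x) fx)
  where
  still-in : ∀ {y} → x ≢ y × f y ≡ true → (f without x) y ≡ true
  still-in (x≢y , fy) = trans (without-other f x≢y) fy

countF≡2⇒one-of : ∀ {k} {f : Fin k → Bool} {x y} → countF f ≡ 2 → f x ≡ true → f y ≡ true →
                  x ≢ y → ∀ {z} → f z ≡ true → z ≡ x ⊎ z ≡ y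
countF≡2⇒one-of {f = f} {x} {y} count≡2 fx fy x≢y {z} fz with z ≟ x | z ≟ y
... | yes z≡x | _      = inj₁ z≡x
... | no _    | yes z≡y = inj₂ z≡y
... | no z≢x  | no z≢y  = contradiction (subst (3 ≤_) count≡2 three≤) λ { (s≤s (s≤s ())) }
  where
  three≤ : 3 ≤ countF f
  three≤ = length≤countF (x ∷ y ∷ z ∷ []) ((x≢y ∷ (z≢x ∘ sym) ∷ []) ∷ ((z≢y ∘ sym) ∷ []) ∷ [] ∷ [])
                         (fx ∷ fy ∷ fz ∷ [])

countF-≤⇒⊇ : ∀ {k} {f g : Fin k → Bool} → f ⊆ g → countF g ≤ countF f → g ⊆ f
countF-≤⇒⊇ {f = f} f⊆g g≤f i gi with f i in fi
... | true  = refl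
... | false = contradiction (<-≤-trans (countF-< f⊆g fi gi) g≤f) (<-irrefl refl)

countF-cong : ∀ {k} {f g : Fin k → Bool} → (∀ i → f i ≡ g i) → countF f ≡ countF g
countF-cong {zero}  _   = refl
countF-cong {suc k} f≗g rewrite f≗g zero = cong (_ +_) (countF-cong (f≗g ∘ suc))

true-false-≢ : ∀ {a b : Bool} → a ≡ true → b ≡ false → a ≢ b
true-false-≢ refl refl ()

xor-cancel-common : ∀ a b c → (a xor c) xor (b xor c) ≡ a xor b
xor-cancel-common a b c = begin
  (a xor c) xor (b xor c) ≡⟨ xor-assoc a c (b xor c) ⟩
  a xor (c xor (b xor c)) ≡⟨ cong (λ x → a xor (c xor x)) (xor-comm b c) ⟩
  a xor (c xor (c xor b)) ≡⟨ cong (a xor_) (sym (xor-assoc c c b)) ⟩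
  a xor ((c xor c) xor b) ≡⟨ cong (λ x → a xor (x xor b)) (xor-same c) ⟩
  a xor b                 ∎
  where open ≡-Reasoning

xor≡true⇒≢ : ∀ {a b} → a xor b ≡ true → a ≢ b
xor≡true⇒≢ {true}  {true}  () _
xor≡true⇒≢ {false} {false} () _

≢⇒xor≡true : ∀ {a b} → a ≢ b → a xor b ≡ true
≢⇒xor≡true {true}  {false} _ = refl
≢⇒xor≡true {false} {true}  _ = refl
≢⇒xor≡true {true}  {true}  a≢b = contradiction refl a≢b
≢⇒xor≡true {false} {false} a≢b = contradiction refl a≢b

module Walks (G : Graph) where

  joins-sym : ∀ {e x y} → Joins G e x y → Joins G e y x
  joins-sym (inj₁ p) = inj₂ p
  joins-sym (inj₂ p) = inj₁ p

  joins⇒incidentˡ : ∀ {e x y} → Joins G e x y → Incident G e x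
  joins⇒incidentˡ (inj₁ (p , _)) = inj₁ p
  joins⇒incidentˡ (inj₂ (_ , q)) = inj₂ q

  incident⇒joins : ∀ {e x} → Incident G e x → ∃[ y ] Joins G e x y
  incident⇒joins {e} (inj₁ p) = tgt G e , inj₁ (p , refl)
  incident⇒joins {e} (inj₂ p) = src G e , inj₂ (refl , p)

  joins-incident : ∀ {e x y z} → Joins G e x y → Incident G e z → z ≡ x ⊎ z ≡ y
  joins-incident (inj₁ (p , _)) (inj₁ q) = inj₁ (trans (sym q) p)
  joins-incident (inj₁ (_ , p)) (inj₂ q) = inj₂ (trans (sym q) p)
  joins-incident (inj₂ (p , _)) (inj₁ q) = inj₂ (trans (sym q) p)
  joins-incident (inj₂ (_ , p)) (inj₂ q) = inj₁ (trans (sym q) p)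

  incident? : ∀ e v → Dec (Incident G e v)
  incident? e v = (src G e ≟ v) ⊎-dec (tgt G e ≟ v)

  crosses⇒joins-≢ : ∀ (X : VSet G) {e x y} → Joins G e x y → Crosses G X e → X x ≢ X y
  crosses⇒joins-≢ X (inj₁ (refl , refl)) c = xor≡true⇒≢ c
  crosses⇒joins-≢ X (inj₂ (refl , refl)) c = xor≡true⇒≢ c ∘ sym

  joins-≢⇒crosses : ∀ (X : VSet G) {e x y} → Joins G e x y → X x ≢ X y → Crosses G X e
  joins-≢⇒crosses X (inj₁ (refl , refl)) ne = ≢⇒xor≡true ne
  joins-≢⇒crosses X (inj₂ (refl , refl)) ne = ≢⇒xor≡true (ne ∘ sym)

  crosses⇒endpoints-≢ : ∀ (X : VSet G) {e x y} → Crosses G X e → Incident G e x → Incident G e y →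
                        x ≢ y → X x ≢ X y
  crosses⇒endpoints-≢ X c (inj₁ refl) (inj₂ refl) _ = xor≡true⇒≢ c
  crosses⇒endpoints-≢ X c (inj₂ refl) (inj₁ refl) _ = xor≡true⇒≢ c ∘ sym
  crosses⇒endpoints-≢ X c (inj₁ refl) (inj₁ refl) x≢y = contradiction refl x≢y
  crosses⇒endpoints-≢ X c (inj₂ refl) (inj₂ refl) x≢y = contradiction refl x≢y

  minus-intro : ∀ (D : ESet G) e {h} → D h ≡ true → h ≢ e → minus G D e h ≡ true
  minus-intro D e {h} Dh h≢e rewrite Dh | dec-false (h ≟ e) h≢e = refl

  minus-elim : ∀ (D : ESet G) e {h} → minus G D e h ≡ true → D h ≡ true × h ≢ e
  minus-elim D e {h} p with D h | h ≟ e
  ... | true | no h≢e = refl , h≢e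

  minus-⊆ : ∀ (D : ESet G) e → minus G D e ⊆ D
  minus-⊆ D e h = proj₁ ∘ minus-elim D e

  minus-mono : ∀ {D D′ : ESet G} e → D ⊆ D′ → minus G D e ⊆ minus G D′ e
  minus-mono {D} {D′} e D⊆D′ h p with minus-elim D e p
  ... | Dh , h≢e = minus-intro D′ e (D⊆D′ h Dh) h≢e

  reach-trans : ∀ {D u v w} → Reach G D u v → Reach G D v w → Reach G D u w
  reach-trans r here             = r
  reach-trans r (step e d r′ j) = step e d (reach-trans r r′) j

  reach-sym : ∀ {D u v} → Reach G D u v → Reach G D v u
  reach-sym here            = here
  reach-sym (step e d r j) = reach-trans (step e d here (joins-sym j)) (reach-sym r)

  reach-mono : ∀ {D D′ u v} → D ⊆ D′ → Reach G D u v → Reach G D′ u v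
  reach-mono D⊆D′ here            = here
  reach-mono D⊆D′ (step e d r j) = step e (D⊆D′ e d) (reach-mono D⊆D′ r) j

  walk-crosses : ∀ (X : VSet G) {D u v} → Reach G D u v → X u ≢ X v → ∃[ e ] (D e ≡ true × Crosses G X e)
  walk-crosses X here Xu≢Xv = contradiction refl Xu≢Xv
  walk-crosses X (step {w} {x} e d r j) Xu≢Xx with X w ≟ᵇ X x
  ... | yes Xw≡Xx = walk-crosses X r (λ Xu≡Xw → Xu≢Xx (trans Xu≡Xw Xw≡Xx))
  ... | no Xw≢Xx  = e , d , joins-≢⇒crosses X j Xw≢Xx

  walkLength : ∀ {D u v} → Reach G D u v → ℕ
  walkLength here            = zero
  walkLength (step _ _ r _) = suc (walkLength r)

  first-use : ∀ {D u v} e (r : Reach G D u v) →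
    (Σ (Reach G (minus G D e) u v) λ r′ → walkLength r′ ≤ walkLength r) ⊎
    (∃[ z ] (Incident G e z × Σ (Reach G (minus G D e) u z) λ r′ → walkLength r′ ≤ walkLength r))
  first-use e here = inj₁ (here , z≤n)
  first-use {D} e (step h d r j) with first-use e r
  ... | inj₂ (z , ez , r′ , ≤r) = inj₂ (z , ez , r′ , m≤n⇒m≤1+n ≤r)
  ... | inj₁ (r′ , ≤r) with h ≟ e
  ...   | yes refl = inj₂ (_ , joins⇒incidentˡ j , r′ , m≤n⇒m≤1+n ≤r)
  ...   | no h≢e   = inj₁ (step h (minus-intro D e d h≢e) r′ j , s≤s ≤r)

  reach-endpoint-avoiding : ∀ {D u v e} → Incident G e v → Reach G D u v →
                            ∃[ z ] (Incident G e z × Reach G (minus G D e) u z)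
  reach-endpoint-avoiding {e = e} ev r with first-use e r
  ... | inj₁ (r′ , _)          = _ , ev , r′
  ... | inj₂ (z , ez , r′ , _) = z , ez , r′

  endpoint-reach-avoiding : ∀ {D u v e} → Incident G e u → Reach G D u v →
                            ∃[ z ] (Incident G e z × Reach G (minus G D e) z v)
  endpoint-reach-avoiding eu r with reach-endpoint-avoiding eu (reach-sym r)
  ... | z , ez , r′ = z , ez , reach-sym r′

does-true : ∀ {A : Set} (a? : Dec A) → does a? ≡ true → A
does-true (yes a) _ = a

module Component (G : Graph) (D : ESet G) (u : Fin (nV G)) where

  open Walks G

  EdgeInto : VSet G → Fin (nV G) → Fin (nE G) → Set
  EdgeInto R x e = D e ≡ true × ∃[ w ] (R w ≡ true × Joins G e w x)

  edgeInto? : ∀ R x e → Dec (EdgeInto R x e)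
  edgeInto? R x e = (D e ≟ᵇ true) ×-dec any? λ w →
    (R w ≟ᵇ true) ×-dec (((src G e ≟ w) ×-dec (tgt G e ≟ x)) ⊎-dec ((src G e ≟ x) ×-dec (tgt G e ≟ w)))

  grow? : (R : VSet G) → ∀ x → Dec (R x ≡ true ⊎ ∃[ e ] EdgeInto R x e)
  grow? R x = (R x ≟ᵇ true) ⊎-dec any? (edgeInto? R x)

  grow : VSet G → VSet G
  grow R x = does (grow? R x)

  grow-⊇ : ∀ R → R ⊆ grow R
  grow-⊇ R x Rx = dec-true (grow? R x) (inj₁ Rx)

  grow-edge : ∀ R {x} e → EdgeInto R x e → grow R x ≡ true
  grow-edge R {x} e into = dec-true (grow? R x) (inj₂ (e , into))

  grow-mono : ∀ {R R′} → R ⊆ R′ → grow R ⊆ grow R′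
  grow-mono {R} {R′} R⊆R′ x p with does-true (grow? R x) p
  ... | inj₁ Rx                      = grow-⊇ R′ x (R⊆R′ x Rx)
  ... | inj₂ (e , De , w , Rw , j) = grow-edge R′ e (De , w , R⊆R′ w Rw , j)

  Closed : VSet G → Set
  Closed R = grow R ⊆ R

  closed? : ∀ R → Closed R ⊎ ∃[ x ] (grow R x ≡ true × R x ≡ false)
  closed? R with any? (λ x → (grow R x ≟ᵇ true) ×-dec (R x ≟ᵇ false))
  ... | yes new = inj₂ new
  ... | no ¬new = inj₁ λ x growRx → ¬-not (λ Rx≡false → ¬new (x , growRx , Rx≡false))

  -- iterate n is the set of vertices reachable from u by a walk of length at most n.
  iterate : ℕ → VSet G
  iterate zero    x = does (x ≟ u)
  iterate (suc n) = grow (iterate n)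

  iterate-sound : ∀ n {x} → iterate n x ≡ true → Reach G D u x
  iterate-sound zero    {x} p with refl ← does-true (x ≟ u) p = here
  iterate-sound (suc n) {x} p with does-true (grow? (iterate n) x) p
  ... | inj₁ x∈                      = iterate-sound n x∈
  ... | inj₂ (e , De , w , w∈ , j) = step e De (iterate-sound n w∈) j

  iterate-closed-or-grows : ∀ n → Closed (iterate n) ⊎ n < countF (iterate n)
  iterate-closed-or-grows zero =
    inj₂ (length≤countF (u ∷ []) ([] ∷ []) (dec-true (u ≟ u) refl ∷ []))
  iterate-closed-or-grows (suc n) with iterate-closed-or-grows n
  ... | inj₁ closed = inj₁ (grow-mono closed)
  ... | inj₂ n< with closed? (iterate n)
  ...   | inj₁ closed          = inj₁ (grow-mono closed)
  ...   | inj₂ (x , new , old) = inj₂ (<-≤-trans (s≤s n<) (countF-< (grow-⊇ (iterate n)) old new))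

  component : VSet G
  component = iterate (nV G)

  component-closed : Closed component
  component-closed with iterate-closed-or-grows (nV G)
  ... | inj₁ closed = closed
  ... | inj₂ nV<    = contradiction (<-≤-trans nV< (countF≤size component)) (<-irrefl refl)

  iterate-∋-u : ∀ n → iterate n u ≡ true
  iterate-∋-u zero    = dec-true (u ≟ u) refl
  iterate-∋-u (suc n) = grow-⊇ (iterate n) u (iterate-∋-u n)

  component-complete : ∀ {x} → Reach G D u x → component x ≡ true
  component-complete here = iterate-∋-u (nV G)
  component-complete (step e De r j) = component-closed _ (grow-edge component e (De , _ , component-complete r , j))

  component-spec : ∀ v → component v ≡ true ⇔ Reach G D u v
  component-spec v = mk⇔ (iterate-sound (nV G)) component-complete

  component-≡ : ∀ {a b} → Reach G D a b → component a ≡ component b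
  component-≡ {a} {b} a→b = ⇔→≡ {z = true} (mk⇔
    (λ a∈ → component-complete (reach-trans (iterate-sound (nV G) a∈) a→b))
    (λ b∈ → component-complete (reach-trans (iterate-sound (nV G) b∈) (reach-sym a→b))))

module _ {C : Graph} (Y : Cycle C) where

  open Walks C

  private
    n : ℕ
    n = j Y

    -- Position m of the cycle; only used for m ≤ suc n, where position suc n is position 0 again.
    at : ℕ → Fin (suc n)
    at m with m <? suc n
    ... | yes m<n = fromℕ< m<n
    ... | no _    = zero

    at-toℕ : ∀ (k : Fin (suc n)) {m} → toℕ k ≡ m → at m ≡ k
    at-toℕ k {m} refl with m <? suc n
    ... | yes m< = toℕ-injective (toℕ-fromℕ< m<)
    ... | no m≮ = contradiction (toℕ<n k) m≮

    at-wraps : at (suc n) ≡ zero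
    at-wraps with suc n <? suc n
    ... | yes n< = contradiction n< (<-irrefl refl)
    ... | no _   = refl

    cycle-joins : ∀ m → m ≤ n → Joins C (link Y (at m)) (node Y (at m)) (node Y (at (suc m)))
    cycle-joins m m≤n with m≤n⇒m<n∨m≡n m≤n
    ... | inj₂ refl = subst₂ (λ a b → Joins C (link Y a) (node Y a) (node Y b))
                             (sym (at-toℕ (fromℕ n) (toℕ-fromℕ n))) (sym at-wraps) (closes Y)
    ... | inj₁ m<n = subst₂ (λ a b → Joins C (link Y a) (node Y a) (node Y b))
                            (sym (at-toℕ (inject₁ k) (trans (toℕ-inject₁ k) (toℕ-fromℕ< m<n))))
                            (sym (at-toℕ (suc k) (cong suc (toℕ-fromℕ< m<n))))
                            (joins Y k)
      where
      k : Fin n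
      k = fromℕ< m<n

    cycle-segment : ∀ {D a} b → a ≤ b → b ≤ suc n → (∀ m → a ≤ m → m < b → D (link Y (at m)) ≡ true) →
                    Reach C D (node Y (at a)) (node Y (at b))
    cycle-segment zero    z≤n _ _ = here
    cycle-segment (suc b) a≤1+b 1+b≤ avail with m≤n⇒m<n∨m≡n a≤1+b
    ... | inj₂ refl      = here
    ... | inj₁ (s≤s a≤b) =
      step (link Y (at b)) (avail b a≤b ≤-refl)
           (cycle-segment b a≤b (<⇒≤ 1+b≤) (λ m a≤m m<b → avail m a≤m (m<n⇒m<1+n m<b)))
           (cycle-joins b (≤-pred 1+b≤))

    toℕ-at : ∀ {m} → m ≤ n → toℕ (at m) ≡ m
    toℕ-at {m} m≤n with m <? suc n
    ... | yes m< = toℕ-fromℕ< m<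
    ... | no m≮  = contradiction (s≤s m≤n) m≮

    off-link : ∀ i {m} → m ≤ n → m ≢ toℕ i → minus C (allE C) (link Y i) (link Y (at m)) ≡ true
    off-link i m≤n m≢i = minus-intro (allE C) (link Y i) refl
      (λ same-link → m≢i (trans (sym (toℕ-at m≤n)) (cong toℕ (link-inj Y same-link))))

    link-joins : ∀ i → Joins C (link Y i) (node Y i) (node Y (at (suc (toℕ i))))
    link-joins i = subst (λ a → Joins C (link Y a) (node Y a) (node Y (at (suc (toℕ i))))) (at-toℕ i refl)
                         (cycle-joins (toℕ i) (≤-pred (toℕ<n i)))

    around-cycle : ∀ i → Reach C (minus C (allE C) (link Y i)) (node Y (at (suc (toℕ i)))) (node Y i)
    around-cycle i =
      subst (Reach C D _) (cong (node Y) (at-toℕ i refl))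
        (reach-trans
          (subst (λ a → Reach C D (node Y (at (suc m))) (node Y a)) (trans at-wraps (sym (at-toℕ zero refl)))
            (cycle-segment (suc n) (s≤s m≤n) ≤-refl
              (λ m′ m<m′ m′≤n → off-link i (≤-pred m′≤n) (≢-sym (<⇒≢ m<m′)))))
          (cycle-segment m z≤n (m≤n⇒m≤1+n m≤n)
            (λ m′ _ m′<m → off-link i (≤-trans (<⇒≤ m′<m) m≤n) (<⇒≢ m′<m))))
      where
      m : ℕ
      m = toℕ i
      m≤n : m ≤ n
      m≤n = ≤-pred (toℕ<n i)
      D : ESet C
      D = minus C (allE C) (link Y i)

  cycle-crossed-twice : ∀ (Q : VSet C) i → Crosses C Q (link Y i) → ∃[ g ] (g ≢ link Y i × Crosses C Q g)
  cycle-crossed-twice Q i crosses with walk-crosses Q (around-cycle i) (≢-sym (crosses⇒joins-≢ Q (link-joins i) crosses))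
  ... | g , Dg , g-crosses = g , proj₂ (minus-elim (allE C) (link Y i) Dg) , g-crosses

Splits : (G : Graph) → VSet G → VSet G → Bool → Set
Splits G X Y b = ∃[ p ] ∃[ q ] (Y p ≡ b × Y q ≡ b × X p ≢ X q)

module Orientation (G : Graph) where

  -- orient X u is X or its complement, whichever contains u.
  orient : VSet G → Fin (nV G) → VSet G
  orient X u v = X v xor not (X u)

  orient-self : ∀ X u → orient X u u ≡ true
  orient-self X u = xor-inverseʳ (X u)

  orient-crossB : ∀ X u e → crossB G (orient X u) e ≡ crossB G X e
  orient-crossB X u e = xor-cancel-common (X (src G e)) (X (tgt G e)) (not (X u))

  orient-≢ : ∀ X u {p q} → X p ≢ X q → orient X u p ≢ orient X u q
  orient-≢ X u {p} {q} Xp≢Xq =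
    xor≡true⇒≢ (trans (xor-cancel-common (X p) (X q) (not (X u))) (≢⇒xor≡true Xp≢Xq))

  orient-other-side : ∀ X u {p} → X p ≡ not (X u) → orient X u p ≡ false
  orient-other-side X u {p} Xp rewrite Xp = xor-same (not (X u))

  orient-splits : ∀ {X Y u} → Splits G X Y (not (Y u)) → Splits G (orient X u) (orient Y u) false
  orient-splits {X} {Y} {u} (p , q , Yp , Yq , Xp≢Xq) =
    p , q , orient-other-side Y u Yp , orient-other-side Y u Yq , orient-≢ X u Xp≢Xq

  cutSize-orient : ∀ X u → cutSize G (orient X u) ≡ cutSize G X
  cutSize-orient X u = countF-cong (orient-crossB X u)

private
  -- (a , b) and (c , d) record the membership of the two endpoints of a link in (Q , Q′).
  diff-crossing⇒crossing : ∀ a b c d → (a xor c ≡ true → (a ∧ b) ∨ (c ∧ d) ≡ true) →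
                           (a ∧ not b) xor (c ∧ not d) ≡ true → b xor d ≡ true
  diff-crossing⇒crossing true  true  true  false _ _ = refl
  diff-crossing⇒crossing true  false true  true  _ _ = refl
  diff-crossing⇒crossing true  true  true  true  _ ()
  diff-crossing⇒crossing true  false true  false _ ()
  diff-crossing⇒crossing true  true  false _     _ ()
  diff-crossing⇒crossing true  false false _     h _ = contradiction (h refl) λ ()
  diff-crossing⇒crossing false _     true  true  _ ()
  diff-crossing⇒crossing false _     true  false h _ = contradiction (h refl) λ ()
  diff-crossing⇒crossing false _     false _     _ ()

  outside-uncrossed : ∀ a b c d → (a xor c ≡ true → (a ∧ b) ∨ (c ∧ d) ≡ true) →
                      (b xor d ≡ true → (a ∧ not b) xor (c ∧ not d) ≡ true) →
                      (not a ∧ not b) xor (not c ∧ not d) ≢ true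
  outside-uncrossed true  _     true  _     _ _  ()
  outside-uncrossed true  _     false true  _ _  ()
  outside-uncrossed true  true  false false _ h′ _ = contradiction (h′ refl) λ ()
  outside-uncrossed true  false false false h _  _ = contradiction (h refl) λ ()
  outside-uncrossed false true  true  _     _ _  ()
  outside-uncrossed false false true  true  _ h′ _ = contradiction (h′ refl) λ ()
  outside-uncrossed false false true  false h _  _ = contradiction (h refl) λ ()
  outside-uncrossed false true  false true  _ _  ()
  outside-uncrossed false false false false _ _  ()
  outside-uncrossed false true  false false _ h′ _ = contradiction (h′ refl) λ ()
  outside-uncrossed false false false true  _ h′ _ = contradiction (h′ refl) λ ()

module _ {C : Graph} (connected : Connected C (allE C)) (on-cycle : ∀ f → Σ (Cycle C) (OnCycle C f)) where

  open Walks C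
  open Orientation C

  two≤cutSize : ∀ (Q : VSet C) {x y} → Q x ≡ true → Q y ≡ false → 2 ≤ cutSize C Q
  two≤cutSize Q {x} {y} Qx Qy with walk-crosses Q (connected x y) (true-false-≢ Qx Qy)
  ... | f , _ , f-crosses with on-cycle f
  ... | Y , i , refl with cycle-crossed-twice Y Q i f-crosses
  ... | g , g≢f , g-crosses =
    length≤countF (g ∷ link Y i ∷ []) ((g≢f ∷ []) ∷ [] ∷ []) (g-crosses ∷ f-crosses ∷ [])

  -- With u ∈ Q ∩ Q′, every link of δ(Q) meets Q ∩ Q′, so δ(Q ∖ Q′) ⊆ δ(Q′); both have two links, so they
  -- coincide, and then no link leaves V ∖ (Q ∪ Q′), which must therefore be empty.
  module _ {Q Q′ : VSet C} (Q-two : IsTwoCut C Q) (Q′-two : IsTwoCut C Q′)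
           {f₁ f₂ u} (f₁≢f₂ : f₁ ≢ f₂) (f₁-crosses : Crosses C Q f₁) (f₂-crosses : Crosses C Q f₂)
           (f₁∋u : Incident C f₁ u) (f₂∋u : Incident C f₂ u) (Qu : Q u ≡ true) (Q′u : Q′ u ≡ true) where

    private
      inQQ′ : VSet C
      inQQ′ v = Q v ∧ Q′ v

      Q∖Q′ : VSet C
      Q∖Q′ v = Q v ∧ not (Q′ v)

      outside : VSet C
      outside v = not (Q v) ∧ not (Q′ v)

      incident-u-anchored : ∀ {g} → Incident C g u → inQQ′ (src C g) ∨ inQQ′ (tgt C g) ≡ true
      incident-u-anchored (inj₁ refl) rewrite Qu | Q′u = refl
      incident-u-anchored (inj₂ refl) rewrite Qu | Q′u = ∨-zeroʳ _

      crossing-anchored : ∀ g → Crosses C Q g → inQQ′ (src C g) ∨ inQQ′ (tgt C g) ≡ true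
      crossing-anchored g g-crosses with countF≡2⇒one-of Q-two f₁-crosses f₂-crosses f₁≢f₂ g-crosses
      ... | inj₁ refl = incident-u-anchored f₁∋u
      ... | inj₂ refl = incident-u-anchored f₂∋u

      Q∖Q′-cut⊆Q′-cut : crossB C Q∖Q′ ⊆ crossB C Q′
      Q∖Q′-cut⊆Q′-cut g = diff-crossing⇒crossing (Q (src C g)) (Q′ (src C g)) (Q (tgt C g)) (Q′ (tgt C g))
                                                 (crossing-anchored g)

      Q′-cut⊆Q∖Q′-cut : ∀ {q} → Q∖Q′ q ≡ true → crossB C Q′ ⊆ crossB C Q∖Q′
      Q′-cut⊆Q∖Q′-cut q∈ = countF-≤⇒⊇ Q∖Q′-cut⊆Q′-cut
        (subst (_≤ cutSize C Q∖Q′) (sym Q′-two) (two≤cutSize Q∖Q′ q∈ u∉))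
        where
        u∉ : Q∖Q′ u ≡ false
        u∉ rewrite Q′u = ∧-zeroʳ (Q u)

      u∉outside : outside u ≡ false
      u∉outside rewrite Qu = refl

      outside-empty : ∀ {q q*} → Q∖Q′ q ≡ true → outside q* ≡ true → ⊥
      outside-empty {q} {q*} q∈ q*∈ with walk-crosses outside (connected q* u) (true-false-≢ q*∈ u∉outside)
      ... | g , _ , g-crosses =
        outside-uncrossed (Q (src C g)) (Q′ (src C g)) (Q (tgt C g)) (Q′ (tgt C g))
                          (crossing-anchored g) (Q′-cut⊆Q∖Q′-cut q∈ g) g-crosses

      ∈Q∖Q′ : ∀ {v} → Q v ≡ true → Q′ v ≡ false → Q∖Q′ v ≡ true
      ∈Q∖Q′ Qv Q′v rewrite Qv | Q′v = refl

      ∈outside : ∀ {v} → Q v ≡ false → Q′ v ≡ false → outside v ≡ true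
      ∈outside Qv Q′v rewrite Qv | Q′v = refl

    oriented-nonsplitting : ¬ Splits C Q Q′ false
    oriented-nonsplitting (p , q , Q′p , Q′q , Qp≢Qq) with Q p in Qp
    ... | true  = outside-empty (∈Q∖Q′ Qp Q′p) (∈outside (¬-not (≢-sym Qp≢Qq)) Q′q)
    ... | false = outside-empty (∈Q∖Q′ (¬-not (≢-sym Qp≢Qq)) Q′q) (∈outside Qp Q′p)

  basicTwoCut-nonsplitting : ∀ {Q Q′ : VSet C} → IsTwoCut C Q → IsTwoCut C Q′ →
    ∀ {f₁ f₂ u} → f₁ ≢ f₂ → Crosses C Q f₁ → Crosses C Q f₂ → Incident C f₁ u → Incident C f₂ u →
    ¬ Splits C Q Q′ (not (Q′ u))
  basicTwoCut-nonsplitting {Q} {Q′} Q-two Q′-two {f₁} {f₂} {u} f₁≢f₂ f₁-crosses f₂-crosses f₁∋u f₂∋u =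
    oriented-nonsplitting
      (trans (cutSize-orient Q u) Q-two) (trans (cutSize-orient Q′ u) Q′-two) f₁≢f₂
      (trans (orient-crossB Q u f₁) f₁-crosses) (trans (orient-crossB Q u f₂) f₂-crosses)
      f₁∋u f₂∋u (orient-self Q u) (orient-self Q′ u)
    ∘ orient-splits

module _ {G : Graph} where

  open Walks G

  K≤cutSize : ∀ {K} → KEdgeConnected G K → ∀ {X : VSet G} {x y} → X x ≡ true → X y ≡ false → K ≤ cutSize G X
  K≤cutSize {K} (_ , robust) {X} {x} {y} Xx Xy with K ≤? cutSize G X
  ... | yes K≤ = K≤
  ... | no K≰ with walk-crosses X (robust (crossB G X) (∸-monoˡ-≤ 1 (≰⇒> K≰)) x y) (true-false-≢ Xx Xy)
  ...   | e , kept , crosses = contradiction (subst (λ b → not b ≡ true) crosses kept) λ ()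

  pairwise-adjacent⇒common-endpoint :
    (Z : VSet G) {F : Fin (nE G) → Set} → Decidable F → Fin (nV G) → (∀ {e} → F e → Crosses G Z e) →
    (∀ {e e′} → F e → F e′ → ∃[ c ] (Incident G e c × Incident G e′ c)) →
    ∃[ v ] (∀ e → F e → Incident G e v)
  pairwise-adjacent⇒common-endpoint Z {F} F? v₀ crossing adjacent with any? F?
  ... | no none = v₀ , λ e Fe → contradiction (e , Fe) none
  ... | yes (e₀ , Fe₀) with any? (λ e → F? e ×-dec ¬? (incident? e (src G e₀)))
  ...   | no none = src G e₀ , λ e Fe → decidable-stable (incident? e (src G e₀)) (λ e∌a → none (e , Fe , e∌a))
  ...   | yes (e₁ , Fe₁ , e₁∌a) = tgt G e₀ , λ e Fe → decidable-stable (incident? e (tgt G e₀)) (triangle Fe)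
    where
    a b : Fin (nV G)
    a = src G e₀
    b = tgt G e₀

    adjacent-to-e₀ : ∀ {e} → F e → Incident G e a ⊎ Incident G e b
    adjacent-to-e₀ Fe with adjacent Fe Fe₀
    ... | c , e∋c , inj₁ refl = inj₁ e∋c
    ... | c , e∋c , inj₂ refl = inj₂ e∋c

    -- Three crossing edges pairwise sharing distinct endpoints a, b, c would put Z a, Z b, Z c pairwise apart.
    triangle : ∀ {e} → F e → ¬ ¬ Incident G e b
    triangle {e} Fe e∌b with adjacent-to-e₀ Fe₁ | adjacent-to-e₀ Fe | adjacent Fe₁ Fe
    ... | inj₁ e₁∋a | _         | _                = e₁∌a e₁∋a
    ... | _         | inj₂ e∋b  | _                = e∌b e∋b
    ... | inj₂ e₁∋b | inj₁ e∋a  | c , e₁∋c , e∋c =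
      xor≡true⇒≢ (crossing Fe₀) (trans (¬-not (≢-sym Zc≢Za)) (sym (¬-not (≢-sym Zc≢Zb))))
      where
      Zc≢Zb : Z c ≢ Z b
      Zc≢Zb = crosses⇒endpoints-≢ Z (crossing Fe₁) e₁∋c e₁∋b λ { refl → e∌b e∋c }
      Zc≢Za : Z c ≢ Z a
      Zc≢Za = crosses⇒endpoints-≢ Z (crossing Fe) e∋c e∋a λ { refl → e₁∌a e₁∋c }

module SpanningTree {G : Graph} {T : ESet G} (tree : IsSpanningTree G T) where

  open Walks G

  acyclic : ∀ {g x y} → T g ≡ true → Joins G g x y → ¬ Reach G (minus G T g) x y
  acyclic {g} Tg (inj₁ (refl , refl)) = proj₂ tree g Tg
  acyclic {g} Tg (inj₂ (refl , refl)) = proj₂ tree g Tg ∘ reach-sym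

  last-edge-separates : ∀ {D h x w y} → D ⊆ T → D h ≡ true → Joins G h w y →
                        Reach G (minus G D h) x w → ¬ Reach G (minus G T h) x y
  last-edge-separates {h = h} D⊆T Dh j x→w x→y =
    acyclic (D⊆T h Dh) j (reach-trans (reach-sym (reach-mono (minus-mono h D⊆T) x→w)) x→y)

  -- If the walk revisits an endpoint of its last edge h, recurse on the shorter prefix; otherwise h separates.
  separating-edge : ∀ n {D} → D ⊆ T → ∀ {x y} (r : Reach G D x y) → walkLength r ≤ n → x ≢ y →
                    ∃[ g ] (D g ≡ true × ¬ Reach G (minus G T g) x y)
  separating-edge _ _ here _ x≢x = contradiction refl x≢x
  separating-edge (suc n) {D} D⊆T (step h Dh r j) (s≤s len≤n) x≢y with first-use h r
  ... | inj₁ (x→w , _) = h , Dh , last-edge-separates D⊆T Dh j x→w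
  ... | inj₂ (z , h∋z , x→z , len′≤) with joins-incident j h∋z
  ...   | inj₁ refl = h , Dh , last-edge-separates D⊆T Dh j x→z
  ...   | inj₂ refl with separating-edge n (λ f → D⊆T f ∘ minus-⊆ D h f) x→z (≤-trans len′≤ len≤n) x≢y
  ...     | g , g∈ , separates = g , minus-⊆ D h g g∈ , separates

  side : Fin (nE G) → VSet G
  side g = Component.component G (minus G T g) (src G g)

  side-spec : ∀ g v → side g v ≡ true ⇔ Reach G (minus G T g) (src G g) v
  side-spec g = Component.component-spec G (minus G T g) (src G g)

  side-≡ : ∀ {g a b} → Reach G (minus G T g) a b → side g a ≡ side g b
  side-≡ {g} = Component.component-≡ G (minus G T g) (src G g)

  side-or-tgt : ∀ g v → side g v ≡ true ⊎ Reach G (minus G T g) (tgt G g) v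
  side-or-tgt g v with endpoint-reach-avoiding (inj₁ refl) (proj₁ tree (src G g) v)
  ... | z , inj₁ refl , z→v = inj₁ (Equivalence.from (side-spec g v) z→v)
  ... | z , inj₂ refl , z→v = inj₂ z→v

  side-src : ∀ g → side g (src G g) ≡ true
  side-src g = Equivalence.from (side-spec g (src G g)) here

  side-tgt : ∀ {g} → T g ≡ true → side g (tgt G g) ≡ false
  side-tgt {g} Tg = ¬-not (acyclic Tg (inj₁ (refl , refl)) ∘ Equivalence.to (side-spec g (tgt G g)))

  side-isKCut : ∀ {K} → KEdgeConnected G K → CongestionAtMost G T K → ∀ {g} → T g ≡ true → IsKCut G K (side g)
  side-isKCut kec congestion {g} Tg =
    ((src G g , side-src g) , (tgt G g , side-tgt Tg)) ,
    ≤-antisym (congestion g Tg (side g) (side-spec g)) (K≤cutSize kec {side g} (side-src g) (side-tgt Tg))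

basicKCut-noncrossing : ∀ {G K} (R : CactusRep G K) {Z S : VSet G} → IsBasicKCut G K R Z → IsKCut G K S →
                        Splits G Z S true → ¬ Splits G Z S false
basicKCut-noncrossing {G} R {Z} {S}
  (_ , Q , Q-two , Z≗Qφ , f₁ , f₂ , f₁≢f₂ , f₁-crosses , f₂-crosses , _ , u , f₁∋u , f₂∋u) S-cut splits-true splits-false
  with Equivalence.to (represents R S) S-cut
... | Q′ , Q′-two , S≗Q′φ =
  basicTwoCut-nonsplitting (proj₁ (isCactus R)) (proj₁ ∘ proj₂ (isCactus R))
    Q-two Q′-two f₁≢f₂ f₁-crosses f₂-crosses f₁∋u f₂∋u (push (splits-opposite (Q′ u)))
  where
  splits-opposite : ∀ b → Splits G Z S (not b)
  splits-opposite true  = splits-false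
  splits-opposite false = splits-true

  push : ∀ {b} → Splits G Z S b → Splits (cactus R) Q Q′ b
  push (p , q , Sp , Sq , Zp≢Zq) =
    φ R p , φ R q , trans (sym (S≗Q′φ p)) Sp , trans (sym (S≗Q′φ q)) Sq ,
    λ Qφp≡Qφq → Zp≢Zq (trans (Z≗Qφ p) (trans Qφp≡Qφq (sym (Z≗Qφ q))))

module _ {K : ℕ} {G : Graph} (kec : KEdgeConnected G K) (R : CactusRep G K)
         {T : ESet G} (tree : IsSpanningTree G T) (congestion : CongestionAtMost G T K)
         {Z : VSet G} (basic : IsBasicKCut G K R Z) where

  open Walks G
  open SpanningTree tree

  private
    minus²-⊆ : ∀ e e′ → minus G (minus G T e) e′ ⊆ T
    minus²-⊆ e e′ h = minus-⊆ T e h ∘ minus-⊆ (minus G T e) e′ h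

    splits-both-sides⇒⊥ : ∀ {g} → T g ≡ true → ∀ {b} → Splits G Z (side g) b → ¬ Splits G Z (side g) (not b)
    splits-both-sides⇒⊥ Tg {true}  = basicKCut-noncrossing R basic (side-isKCut kec congestion Tg)
    splits-both-sides⇒⊥ Tg {false} = flip (basicKCut-noncrossing R basic (side-isKCut kec congestion Tg))

    edge-splits-side : ∀ {g e x} → minus G T g e ≡ true → Crosses G Z e → Incident G e x →
                       Splits G Z (side g) (side g x)
    edge-splits-side e∈ crosses e∋x with incident⇒joins e∋x
    ... | x* , j = _ , x* , refl , sym (side-≡ (step _ e∈ here j)) , crosses⇒joins-≢ Z j crosses

    both-in-side⇒reach : ∀ {g x y} → side g x ≡ true → side g y ≡ true → Reach G (minus G T g) x y
    both-in-side⇒reach {g} {x} {y} x∈ y∈ =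
      reach-trans (reach-sym (Equivalence.to (side-spec g x) x∈)) (Equivalence.to (side-spec g y) y∈)

    same-side⇒reach : ∀ {g x y} → side g x ≡ side g y → Reach G (minus G T g) x y
    same-side⇒reach {g} {x} {y} same with side-or-tgt g x | side-or-tgt g y
    ... | inj₁ x∈     | _           = both-in-side⇒reach x∈ (trans (sym same) x∈)
    ... | _           | inj₁ y∈     = both-in-side⇒reach (trans same y∈) y∈
    ... | inj₂ tgt→x | inj₂ tgt→y = reach-trans (reach-sym tgt→x) tgt→y

  crossing-edges-connected : ∀ {g e e′ x y} → T g ≡ true → minus G T g e ≡ true → minus G T g e′ ≡ true →
                             Crosses G Z e → Crosses G Z e′ → Incident G e x → Incident G e′ y →
                             Reach G (minus G T g) x y
  crossing-edges-connected {g} {x = x} {y} Tg e∈ e′∈ e-crosses e′-crosses e∋x e′∋y with side g x ≟ᵇ side g y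
  ... | yes same  = same-side⇒reach same
  ... | no differ =
    contradiction (subst (Splits G Z (side g)) (¬-not (differ ∘ sym)) (edge-splits-side e′∈ e′-crosses e′∋y))
                  (splits-both-sides⇒⊥ Tg (edge-splits-side e∈ e-crosses e∋x))

  -- If e and e′ were disjoint, an edge g on the tree path between them would separate them in T,
  -- although crossing-edges-connected joins them in T − g.
  crossing-tree-edges-adjacent : ∀ {e e′} → T e ≡ true → T e′ ≡ true → Crosses G Z e → Crosses G Z e′ →
                                 ∃[ c ] (Incident G e c × Incident G e′ c)
  crossing-tree-edges-adjacent {e} {e′} Te Te′ e-crosses e′-crosses
    with any? (λ c → incident? e c ×-dec incident? e′ c)
  ... | yes common = common
  ... | no disjoint with endpoint-reach-avoiding (inj₁ refl) (proj₁ tree (src G e) (src G e′))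
  ...   | x , e∋x , x→src with reach-endpoint-avoiding (inj₁ refl) x→src
  ...     | y , e′∋y , x→y with separating-edge _ (minus²-⊆ e e′) x→y ≤-refl (λ { refl → disjoint (x , e∋x , e′∋y) })
  ...       | g , g∈ , separates with minus-elim (minus G T e) e′ g∈
  ...         | g∈T-e , g≢e′ with minus-elim T e g∈T-e
  ...           | Tg , g≢e =
    contradiction (crossing-edges-connected Tg (minus-intro T g Te (g≢e ∘ sym)) (minus-intro T g Te′ (g≢e′ ∘ sym))
                                        e-crosses e′-crosses e∋x e′∋y) separates

mainTheorem6 : (K : ℕ) → 1 ≤ K → (G : Graph) → KEdgeConnected G K →
               (R : CactusRep G K) → (T : ESet G) → IsSpanningTree G T →
               CongestionAtMost G T K →
               (Z : VSet G) → IsBasicKCut G K R Z →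
               ∃[ v ] (∀ e → T e ≡ true → Crosses G Z e → Incident G e v)
mainTheorem6 K _ G kec R T tree congestion Z basic =
  map₂ (λ common e → curry (common e))
    (pairwise-adjacent⇒common-endpoint Z crossing-tree-edge? some-vertex proj₂
      λ (Te , e-crosses) (Te′ , e′-crosses) →
        crossing-tree-edges-adjacent kec R tree congestion basic Te Te′ e-crosses e′-crosses)
  where
  crossing-tree-edge? : Decidable (λ e → T e ≡ true × Crosses G Z e)
  crossing-tree-edge? e = (T e ≟ᵇ true) ×-dec (crossB G Z e ≟ᵇ true)

  some-vertex : Fin (nV G)
  some-vertex = proj₁ (proj₁ (proj₁ (proj₁ basic)))
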